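{- Let $n\ge1$. (a) For $\lambda\in Par_{\le n}$, $\widetilde{Rec}_{2n}(\lambda/\lambda)$ consists of exactly one element, the empty filling of $D(\lambda/\lambda)$. (b) For $l\ge0$, $\widetilde{Rec}_{2n}((1^l))\neq\emptyset$ if and only if $l$ is even and $l\le 2n$; in that case $\widetilde{Rec}_{2n}((1^l))$ consists exactly of the single column of length $l$ all of whose entries equal $1$.
   Context: $Par_{\le m}$: partitions with at most $m$ parts; $(1^l)$ is the single-column partition of length $l$. For $\lambda\in Par_{\le2n}$, $\mu\in Par_{\le n}$, $\mu\subseteq\lambda$, $\widetilde{Rec}_{2n}(\lambda/\mu)$ is the set of fillings $Q$ of $D(\lambda/\mu)$ by positive integers with (R1) entries strictly decreasing along rows left to right; (R2) entries weakly decreasing down columns; (R3) the number $Q[k]$ of entries equal to $k$ is even for all $k>0$; (R4) $Q[k]\ge2(\ell(\mu^{(k-1)})-n)$ for all $k>0$, where $D(\mu^{(k-1)})=D(\mu)\cup\{c\in D(\lambda/\mu):Q(c)\ge k\}$; (R5) $Q_{\le r}[k+1]\le Q_{\le r}[k]$ for all $r,k>0$, where $Q_{\le r}[k]$ counts entries $k$ in rows $1,\dots,r$. $\widetilde{Rec}_{2n}((1^l))$ means $\widetilde{Rec}_{2n}((1^l)/\emptyset)$. -}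

module Defs where

open import Data.Nat using (ℕ; zero; suc; _+_; _*_; _∸_; _≤_; _<_; _≥_; _>_; _≤ᵇ_; _<ᵇ_; _≡ᵇ_)
open import Data.Nat.Divisibility using (_∣_)
open import Data.Bool using (Bool; true; false; _∨_)
open import Data.List using (List; []; _∷_; length; map; filterᵇ; take; upTo; replicate)
open import Data.Nat.ListAction using (sum)
open import Data.Bool.ListAction using (any)
open import Data.List.Relation.Unary.All using (All)
open import Data.List.Relation.Unary.Linked using (Linked)
open import Data.Maybe using (Maybe; just; nothing)
open import Data.Product using (_×_)
open import Relation.Binary.PropositionalEquality using (_≡_)

-- Partitions are lists of positive parts, weakly decreasing.
-- Rows are indexed from 0 internally (row i here = row i+1 in the paper).

IsPartition : List ℕ → Set
IsPartition p = Linked _≥_ p × All (λ x → 0 < x) p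

Par≤ : ℕ → List ℕ → Set
Par≤ m p = IsPartition p × length p ≤ m

part : List ℕ → ℕ → ℕ
part []       _       = 0
part (x ∷ _)  zero    = x
part (_ ∷ xs) (suc i) = part xs i

_⊆ᵖ_ : List ℕ → List ℕ → Set
mu ⊆ᵖ la = ∀ i → part mu i ≤ part la i

column : ℕ → List ℕ
column l = replicate l 1

nth : {A : Set} → List A → ℕ → Maybe A
nth []       _       = nothing
nth (x ∷ _)  zero    = just x
nth (_ ∷ xs) (suc i) = nth xs i

-- A filling of D(λ/μ) is stored as a list of rows; row i lists, from left
-- to right, the entries in the cells (i , j) with part mu i ≤ j < part la i.
Filling : Set
Filling = List (List ℕ)

rowOf : Filling → ℕ → List ℕ
rowOf Q i with nth Q i
... | just r  = r
... | nothing = []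

HasShape : List ℕ → List ℕ → Filling → Set
HasShape la mu Q = (length Q ≡ length la) × (∀ i → length (rowOf Q i) ≡ part la i ∸ part mu i)

-- entry of cell (i , j) (0-indexed row and column), nothing if not a cell of D(λ/μ)
cell : List ℕ → Filling → ℕ → ℕ → Maybe ℕ
cell mu Q i j with part mu i ≤ᵇ j
... | true  = nth (rowOf Q i) (j ∸ part mu i)
... | false = nothing

countRow : ℕ → List ℕ → ℕ
countRow k r = length (filterᵇ (λ x → x ≡ᵇ k) r)

cnt : ℕ → Filling → ℕ
cnt k Q = sum (map (countRow k) Q)

cntUpTo : ℕ → ℕ → Filling → ℕ
cntUpTo r k Q = cnt k (take r Q)

-- ℓ(μ^{(k-1)}) : number of rows of D(μ) ∪ {c ∈ D(λ/μ) : Q(c) ≥ k} containing a cell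
ellMu : List ℕ → Filling → ℕ → ℕ
ellMu mu Q k = length (filterᵇ (λ i → (0 <ᵇ part mu i) ∨ any (k ≤ᵇ_) (rowOf Q i)) (upTo (length Q)))

Rec : ℕ → List ℕ → List ℕ → Filling → Set
Rec n la mu Q =
  HasShape la mu Q
  × All (All (λ x → 0 < x)) Q
  × All (Linked _>_) Q                                                      -- (R1)
  × (∀ i j x y → cell mu Q i j ≡ just x → cell mu Q (suc i) j ≡ just y → y ≤ x) -- (R2)
  × (∀ k → 0 < k → 2 ∣ cnt k Q)                                            -- (R3)
  × (∀ k → 0 < k → 2 * (ellMu mu Q k ∸ n) ≤ cnt k Q)                       -- (R4)
  × (∀ r k → 0 < r → 0 < k → cntUpTo r (suc k) Q ≤ cntUpTo r k Q)          -- (R5)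

-- On the empty skew shape λ/λ the only filling is the empty one, all counts vanish,
-- and (R4) holds because ℓ(μ⁽ᵏ⁻¹⁾) ≤ ℓ(λ) ≤ n.
-- For a single column, (R5) in the first row forces the top entry to be 1, and (R2)
-- with positivity propagates 1 down the column, so the all-ones column is the only
-- candidate. For it every count Q[k] with k ≥ 2 vanishes, (R3) at k = 1 says that l
-- is even, and (R4) at k = 1 reads 2(l ∸ n) ≤ l, i.e. l ≤ 2n.
module Submission where

open import Defs
open import Data.Bool using (T; true; false)
open import Data.Bool.ListAction using (any)
open import Data.Empty using (⊥; ⊥-elim)
open import Data.List using (List; []; _∷_; length; replicate; take; upTo)
open import Data.List.Properties using (length-replicate; length-upTo; length-filter; filter-all; filter-none)
open import Data.List.Relation.Unary.All as All using (All; []; _∷_)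
open import Data.List.Relation.Unary.All.Properties using (replicate⁺; applyUpTo⁺₁; applyUpTo⁺₂)
open import Data.List.Relation.Unary.Any as Any using (Any)
open import Data.List.Relation.Unary.Any.Properties using (any⁺; any⁻)
open import Data.List.Relation.Unary.Linked as Linked using ([-])
open import Data.Maybe using (just)
open import Data.Nat using (ℕ; zero; suc; _+_; _*_; _∸_; _≤_; _<_; _≡ᵇ_; _≤ᵇ_; z≤n; s≤s; z<s; _≤?_)
open import Data.Nat.Properties
open import Data.Nat.Divisibility using (_∣_; _∣0)
open import Data.Product using (_×_; _,_; ∃)
open import Function using (_∘_; id; _⇔_; mk⇔; Equivalence)
open import Function.Properties.Equivalence as ⇔ using ()
open import Relation.Nullary using (yes; no; ¬_)
open import Relation.Nullary.Decidable using (T?)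
open import Relation.Binary.PropositionalEquality using (_≡_; _≢_; refl; sym; trans; cong; cong₂; subst; subst₂)

ColumnsWeaklyDecrease : List ℕ → Filling → Set
ColumnsWeaklyDecrease mu Q =
  ∀ i j x y → cell mu Q i j ≡ just x → cell mu Q (suc i) j ≡ just y → y ≤ x

PrefixCountsDecrease : Filling → Set
PrefixCountsDecrease Q = ∀ r k → 0 < r → 0 < k → cntUpTo r (suc k) Q ≤ cntUpTo r k Q

onesColumn : ℕ → Filling
onesColumn l = replicate l (1 ∷ [])

rowOf-All : ∀ {P : List ℕ → Set} → P [] → ∀ {Q} → All P Q → ∀ i → P (rowOf Q i)
rowOf-All p[] []       i       = p[]
rowOf-All p[] (p ∷ _)  zero    = p
rowOf-All p[] (_ ∷ ps) (suc i) = rowOf-All p[] ps i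

rowOf-All-< : ∀ {P : List ℕ → Set} {Q} → All P Q → ∀ {i} → i < length Q → P (rowOf Q i)
rowOf-All-< (p ∷ _)  {zero}  _         = p
rowOf-All-< (_ ∷ ps) {suc i} (s≤s i<n) = rowOf-All-< ps i<n

length-rowOf-replicate : ∀ m r i → length (rowOf (replicate m r) i) ≡ part (replicate m (length r)) i
length-rowOf-replicate zero    r i       = refl
length-rowOf-replicate (suc m) r zero    = refl
length-rowOf-replicate (suc m) r (suc i) = length-rowOf-replicate m r i

nth-All : ∀ {P : ℕ → Set} {r} → All P r → ∀ j {x} → nth r j ≡ just x → P x
nth-All (p ∷ _)  zero    refl = p
nth-All (_ ∷ ps) (suc j) e    = nth-All ps j e

cell-All : ∀ {P : ℕ → Set} mu {Q} → All (All P) Q → ∀ i j {x} → cell mu Q i j ≡ just x → P x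
cell-All mu a i j e with part mu i ≤ᵇ j
cell-All mu a i j e  | true = nth-All (rowOf-All [] a i) (j ∸ part mu i) e
cell-All mu a i j () | false

countRow-all : ∀ {k} r → All (_≡ k) r → countRow k r ≡ length r
countRow-all {k} r eqs = cong length (filter-all (T? ∘ (_≡ᵇ k)) (All.map (λ { refl → ≡⇒≡ᵇ k k refl }) eqs))

countRow-none : ∀ {k} r → All (_≢ k) r → countRow k r ≡ 0
countRow-none r neqs = cong length (filter-none (T? ∘ (_≡ᵇ _)) (All.map (λ x≢k → x≢k ∘ ≡ᵇ⇒≡ _ _) neqs))

cnt-none : ∀ {k} {Q} → All (All (_≢ k)) Q → cnt k Q ≡ 0
cnt-none {Q = []}    []         = refl
cnt-none {Q = r ∷ _} (nr ∷ nQ) = cong₂ _+_ (countRow-none r nr) (cnt-none nQ)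

cnt-onesColumn : ∀ l → cnt 1 (onesColumn l) ≡ l
cnt-onesColumn zero    = refl
cnt-onesColumn (suc l) = cong suc (cnt-onesColumn l)

cnt-take-≤ : ∀ k r Q → cnt k (take r Q) ≤ cnt k Q
cnt-take-≤ k zero    Q       = z≤n
cnt-take-≤ k (suc r) []      = z≤n
cnt-take-≤ k (suc r) (x ∷ Q) = +-monoʳ-≤ (countRow k x) (cnt-take-≤ k r Q)

cntUpTo-none : ∀ {k} r {Q} → All (All (_≢ k)) Q → cntUpTo r k Q ≡ 0
cntUpTo-none r {Q} nQ = n≤0⇒n≡0 (≤-trans (cnt-take-≤ _ r Q) (≤-reflexive (cnt-none nQ)))

ellMu-≤-length : ∀ mu Q k → ellMu mu Q k ≤ length Q
ellMu-≤-length mu Q k = subst (ellMu mu Q k ≤_) (length-upTo (length Q)) (length-filter _ (upTo (length Q)))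

ellMu-full : ∀ k Q → All (Any (k ≤_)) Q → ellMu [] Q k ≡ length Q
ellMu-full k Q hits = trans (cong length (filter-all (T? ∘ _) rowsHit)) (length-upTo (length Q))
  where
  rowsHit : All (λ i → T (any (k ≤ᵇ_) (rowOf Q i))) (upTo (length Q))
  rowsHit = applyUpTo⁺₁ id (length Q) (λ i<n → any⁺ _ (Any.map ≤⇒≤ᵇ (rowOf-All-< hits i<n)))

ellMu-none : ∀ k Q → All (All (_< k)) Q → ellMu [] Q k ≡ 0
ellMu-none k Q small = cong length (filter-none (T? ∘ _) (applyUpTo⁺₂ id (length Q) rowMisses))
  where
  rowMisses : ∀ i → ¬ T (any (k ≤ᵇ_) (rowOf Q i))
  rowMisses i hit = All.lookupWith {R = λ _ → ⊥} (λ x<k k≤x → <⇒≱ x<k (≤ᵇ⇒≤ _ _ k≤x))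
                                   (rowOf-All [] small i) (any⁻ _ _ hit)

2*[l∸n]≤l⇔l≤2*n : ∀ n l → 2 * (l ∸ n) ≤ l ⇔ l ≤ 2 * n
2*[l∸n]≤l⇔l≤2*n n l with l ≤? n
... | yes l≤n rewrite m≤n⇒m∸n≡0 l≤n = mk⇔ (λ _ → ≤-trans l≤n (m≤m+n n (n + 0))) (λ _ → z≤n)
... | no l≰n with d , refl ← m≤n⇒∃[o]m+o≡n (≰⇒≥ l≰n) rewrite m+n∸m≡n n d =
  ⇔.trans (2*d≤n+d⇔d≤n n d) (⇔.sym (n+d≤2*n⇔d≤n n d))
  where
  2*d≤n+d⇔d≤n : ∀ n d → 2 * d ≤ n + d ⇔ d ≤ n
  2*d≤n+d⇔d≤n n d rewrite +-identityʳ d = mk⇔ (+-cancelʳ-≤ d d n) (+-monoˡ-≤ d)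
  n+d≤2*n⇔d≤n : ∀ n d → n + d ≤ 2 * n ⇔ d ≤ n
  n+d≤2*n⇔d≤n n d rewrite +-identityʳ n = mk⇔ (+-cancelˡ-≤ n d n) (+-monoʳ-≤ n)

emptyRows⇒replicate : ∀ Q → (∀ i → length (rowOf Q i) ≡ 0) → Q ≡ replicate (length Q) []
emptyRows⇒replicate []            _    = refl
emptyRows⇒replicate ([] ∷ Q)      rows = cong ([] ∷_) (emptyRows⇒replicate Q (rows ∘ suc))
emptyRows⇒replicate ((_ ∷ _) ∷ Q) rows with () ← rows 0

rec-empty : ∀ n la → length la ≤ n → Rec n la la (replicate (length la) [])
rec-empty n la ℓ≤n =
  ( (length-replicate m , λ i → trans (cong length (rowOf-All {P = _≡ []} refl (replicate⁺ m refl) i)) (sym (n∸n≡0 (part la i))))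
  , noEntries
  , replicate⁺ m Linked.[]
  , (λ i j x y ex _ → cell-All {P = λ _ → y ≤ x} la noEntries i j ex)
  , (λ k _ → subst (2 ∣_) (sym (cnt-none noEntries)) (2 ∣0))
  , (λ k _ → subst (λ e → 2 * e ≤ cnt k Q) (sym (m≤n⇒m∸n≡0 (ellMu≤n k))) z≤n)
  , (λ r k _ _ → subst (_≤ cntUpTo r k Q) (sym (cntUpTo-none r noEntries)) z≤n) )
  where
  m : ℕ
  m = length la
  Q : Filling
  Q = replicate m []
  noEntries : ∀ {P : ℕ → Set} → All (All P) Q
  noEntries = replicate⁺ m []
  ellMu≤n : ∀ k → ellMu la Q k ≤ n
  ellMu≤n k = ≤-trans (ellMu-≤-length la Q k) (subst (_≤ n) (sym (length-replicate m)) ℓ≤n)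

rec-diagonal⇔empty : ∀ n la → length la ≤ n → (Q : Filling) → Rec n la la Q ⇔ (Q ≡ replicate (length la) [])
rec-diagonal⇔empty n la ℓ≤n Q = mk⇔ forced (λ { refl → rec-empty n la ℓ≤n })
  where
  forced : Rec n la la Q → Q ≡ replicate (length la) []
  forced ((ℓQ , rows) , _) =
    subst (λ m → Q ≡ replicate m []) ℓQ (emptyRows⇒replicate Q (λ i → trans (rows i) (n∸n≡0 (part la i))))

ellMu-onesColumn : ∀ l → ellMu [] (onesColumn l) 1 ≡ l
ellMu-onesColumn l = trans (ellMu-full 1 (onesColumn l) (replicate⁺ l (Any.here ≤-refl))) (length-replicate l)

rec-onesColumn : ∀ n l → 2 ∣ l → l ≤ 2 * n → Rec n (column l) [] (onesColumn l)
rec-onesColumn n l 2∣l l≤2n =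
  ( (trans (length-replicate l) (sym (length-replicate l)) , length-rowOf-replicate l (1 ∷ []))
  , replicate⁺ l (z<s ∷ [])
  , replicate⁺ l [-]
  , (λ i j x y ex ey → ≤-reflexive (trans (cell-All [] ones (suc i) j ey) (sym (cell-All [] ones i j ex))))
  , r3
  , r4
  , r5 )
  where
  ones : All (All (_≡ 1)) (onesColumn l)
  ones = replicate⁺ l (refl ∷ [])
  r3 : ∀ k → 0 < k → 2 ∣ cnt k (onesColumn l)
  r3 (suc zero)    _ = subst (2 ∣_) (sym (cnt-onesColumn l)) 2∣l
  r3 (suc (suc k)) _ = subst (2 ∣_) (sym (cnt-none (replicate⁺ l ((λ ()) ∷ [])))) (2 ∣0)
  r4 : ∀ k → 0 < k → 2 * (ellMu [] (onesColumn l) k ∸ n) ≤ cnt k (onesColumn l)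
  r4 (suc zero)    _ rewrite ellMu-onesColumn l | cnt-onesColumn l = Equivalence.from (2*[l∸n]≤l⇔l≤2*n n l) l≤2n
  r4 (suc (suc k)) _ rewrite ellMu-none (suc (suc k)) (onesColumn l) (replicate⁺ l (s≤s (s≤s z≤n) ∷ [])) | 0∸n≡0 n = z≤n
  r5 : PrefixCountsDecrease (onesColumn l)
  r5 _ zero    _ ()
  r5 r (suc k) _ _ = subst (_≤ cntUpTo r (suc k) (onesColumn l)) (sym (cntUpTo-none r (replicate⁺ l ((λ ()) ∷ [])))) z≤n

part-column≤1 : ∀ l i → part (column l) i ≤ 1
part-column≤1 zero    i       = z≤n
part-column≤1 (suc l) zero    = ≤-refl
part-column≤1 (suc l) (suc i) = part-column≤1 l i

-- A first-row entry a ≥ 2 would be counted by Q_{≤1}[a] but not by Q_{≤1}[a-1].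
topEntry≤1 : ∀ Q → length (rowOf Q 0) ≤ 1 → PrefixCountsDecrease Q → ∀ {x} → cell [] Q 0 0 ≡ just x → x ≤ 1
topEntry≤1 ((zero ∷ [])             ∷ _)    _ _  refl = z≤n
topEntry≤1 ((suc zero ∷ [])         ∷ _)    _ _  refl = ≤-refl
topEntry≤1 ((a@(suc (suc m)) ∷ []) ∷ rest) _ r5 refl = ⊥-elim (1+n≰n {0} (begin
  1                                    ≡⟨ cong (_+ 0) (sym (countRow-all (a ∷ []) (refl ∷ []))) ⟩
  cntUpTo 1 a ((a ∷ []) ∷ rest)        ≤⟨ r5 1 (suc m) z<s z<s ⟩
  cntUpTo 1 (suc m) ((a ∷ []) ∷ rest)  ≡⟨ cong (_+ 0) (countRow-none (a ∷ []) (1+n≢n ∷ [])) ⟩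
  0                                    ∎))
  where open ≤-Reasoning
topEntry≤1 ((_ ∷ _ ∷ _) ∷ _) (s≤s ()) _ _
topEntry≤1 []                _        _ ()
topEntry≤1 ([] ∷ _)          _        _ ()

onesColumn-unique : ∀ l Q → HasShape (column l) [] Q → All (All (0 <_)) Q → ColumnsWeaklyDecrease [] Q →
                    (∀ {x} → cell [] Q 0 0 ≡ just x → x ≤ 1) → Q ≡ onesColumn l
onesColumn-unique zero    []                 _           _                   _  _   = refl
onesColumn-unique (suc l) ((a ∷ []) ∷ Q)     (ℓQ , rows) ((0<a ∷ []) ∷ pos) r2 top =
  cong₂ _∷_ (cong (_∷ []) (≤-antisym a≤1 0<a))
            (onesColumn-unique l Q (suc-injective ℓQ , rows ∘ suc) pos (λ i → r2 (suc i))
                               (λ ey → ≤-trans (r2 0 0 a _ refl ey) a≤1))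
  where
  a≤1 : a ≤ 1
  a≤1 = top refl
onesColumn-unique (suc l) ([] ∷ _)           (_ , rows) _ _ _ with () ← rows 0
onesColumn-unique (suc l) ((_ ∷ _ ∷ _) ∷ _)  (_ , rows) _ _ _ with () ← rows 0
onesColumn-unique zero    (_ ∷ _)            (() , _)   _ _ _
onesColumn-unique (suc l) []                 (() , _)   _ _ _

rec-column-forced : ∀ n l Q → Rec n (column l) [] Q → Q ≡ onesColumn l
rec-column-forced n l Q (shape@(_ , rows) , pos , _ , r2 , _ , _ , r5) =
  onesColumn-unique l Q shape pos r2 (topEntry≤1 Q (subst (_≤ 1) (sym (rows 0)) (part-column≤1 l 0)) r5)

rec-column-nonempty⇔ : ∀ n l → (∃ λ Q → Rec n (column l) [] Q) ⇔ (2 ∣ l × l ≤ 2 * n)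
rec-column-nonempty⇔ n l = mk⇔ conditions (λ (2∣l , l≤2n) → onesColumn l , rec-onesColumn n l 2∣l l≤2n)
  where
  conditions : (∃ λ Q → Rec n (column l) [] Q) → 2 ∣ l × l ≤ 2 * n
  conditions (Q , rec@(_ , _ , _ , _ , r3 , r4 , _)) with refl ← rec-column-forced n l Q rec =
    subst (2 ∣_) (cnt-onesColumn l) (r3 1 z<s) ,
    Equivalence.to (2*[l∸n]≤l⇔l≤2*n n l)
      (subst₂ (λ e c → 2 * (e ∸ n) ≤ c) (ellMu-onesColumn l) (cnt-onesColumn l) (r4 1 z<s))

mainTheorem4 : (n : ℕ) → 1 ≤ n →
    ((la : List ℕ) → Par≤ n la → (Q : Filling) →
       Rec n la la Q ⇔ (Q ≡ replicate (length la) []))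
    × ((l : ℕ) →
       ((∃ λ Q → Rec n (column l) [] Q) ⇔ ((2 ∣ l) × l ≤ 2 * n))
       × ((2 ∣ l) → l ≤ 2 * n → (Q : Filling) →
            Rec n (column l) [] Q ⇔ (Q ≡ replicate l (1 ∷ []))))
mainTheorem4 n _ =
  (λ la (_ , ℓ≤n) → rec-diagonal⇔empty n la ℓ≤n) ,
  (λ l → rec-column-nonempty⇔ n l ,
         λ 2∣l l≤2n Q → mk⇔ (rec-column-forced n l Q) (λ { refl → rec-onesColumn n l 2∣l l≤2n }))
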